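{- Let $G$ be a graph of order $n$. If the clique number $\omega(G)\leq 4$, then $\lambda(M(G))\leq 2n$.
   Context: An $L(2,1)$-labeling of $G$ is a map $f:V\to\{0,1,2,\dots\}$ with $|f(x)-f(y)|\ge 2$ if $d_G(x,y)=1$ and $|f(x)-f(y)|\ge1$ if $d_G(x,y)=2$; $\lambda(G)$ is the minimum over such $f$ of the largest label. For $V=\{v_1,\dots,v_n\}$, $M(G)$ has vertex set $V\cup\{v_1',\dots,v_n'\}\cup\{u\}$ and edge set $E\cup\{v_iv_j' : v_iv_j\in E\}\cup\{v_i'u: 1\le i\le n\}$. -}

module Defs where

open import Data.Nat.Base using (ℕ; _≤_; _≥_; ∣_-_∣; _*_)
open import Data.Fin.Base using (Fin)
open import Data.Product.Base using (Σ; ∃; _×_; _,_)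
open import Data.Empty using (⊥)
open import Data.Unit using (⊤)
open import Function.Definitions using (Injective)
open import Relation.Nullary using (¬_; Dec)
open import Relation.Binary.PropositionalEquality using (_≡_; _≢_)

record Graph (n : ℕ) : Set₁ where
  field
    Adj   : Fin n → Fin n → Set
    sym   : ∀ {x y} → Adj x y → Adj y x
    irr   : ∀ {x} → ¬ Adj x x
    adj?  : ∀ x y → Dec (Adj x y)
open Graph public

IsClique : ∀ {n k} → Graph n → (Fin k → Fin n) → Set
IsClique G f = Injective _≡_ _≡_ f × (∀ i j → i ≢ j → Adj G (f i) (f j))

CliqueNumber≤ : ∀ {n} → Graph n → ℕ → Set
CliqueNumber≤ {n} G m = ∀ k (f : Fin k → Fin n) → IsClique G f → k ≤ m

-- Vertices of M(G): v_i, v_i', u.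
data MV (n : ℕ) : Set where
  orig : Fin n → MV n
  copy : Fin n → MV n
  root : MV n

MAdj : ∀ {n} → Graph n → MV n → MV n → Set
MAdj G (orig i) (orig j) = Adj G i j
MAdj G (orig i) (copy j) = Adj G i j
MAdj G (copy i) (orig j) = Adj G j i
MAdj G (copy i) (copy j) = ⊥
MAdj G (copy i) root     = ⊤
MAdj G root (copy j)     = ⊤
MAdj G (orig i) root     = ⊥
MAdj G root (orig j)     = ⊥
MAdj G root root         = ⊥

Dist2 : {V : Set} → (V → V → Set) → V → V → Set
Dist2 {V} A x y = x ≢ y × ¬ A x y × Σ V (λ z → A x z × A z y)

IsL21 : {V : Set} → (V → V → Set) → (V → ℕ) → Set
IsL21 {V} A f =
  (∀ x y → A x y → ∣ f x - f y ∣ ≥ 2) ×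
  (∀ x y → Dist2 A x y → f x ≢ f y)

Lambda≤ : {V : Set} → (V → V → Set) → ℕ → Set
Lambda≤ {V} A k = Σ (V → ℕ) λ f → IsL21 A f × (∀ v → f v ≤ k)

-- Greedily split V(G) into pairs of non-adjacent vertices and a leftover clique,
-- which has at most four vertices. Then list all 2n + 1 vertices of M(G) so that
-- consecutive entries are non-adjacent in M(G): a pair (a , b) contributes the block
-- a', a, b, b', and the clique vertices together with u are placed around the blocks.
-- Labelling every vertex by its position in the list gives distinct labels, and
-- adjacent vertices never receive consecutive labels.
module Submission where

open import Defs
open import Data.Nat.Base using (ℕ; zero; suc; _+_; _*_; _≤_; z≤n; s≤s; ∣_-_∣; pred)
open import Data.Nat.Properties using (≤-pred; ≤-trans; ≤-reflexive; *-suc)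
open import Data.Nat.Tactic.RingSolver using (solve-∀)
open import Data.Fin.Base using (Fin; toℕ) renaming (zero to fzero; suc to fsuc)
open import Data.Fin.Properties using (toℕ-injective; toℕ<n; _≟_)
open import Data.List.Base using (List; []; _∷_; _++_; length; lookup; map; allFin)
open import Data.List.Properties
  using (length-++; length-map; length-tabulate; ++-identityʳ; ++-assoc)
open import Data.List.Relation.Unary.All as All using (All; []; _∷_)
open import Data.List.Relation.Unary.Any using (here; there; index)
open import Data.List.Relation.Unary.Any.Properties using (lookup-index)
open import Data.List.Relation.Unary.AllPairs using (AllPairs; []; _∷_)
open import Data.List.Relation.Unary.Linked using (Linked; []; [-]; _∷_)
open import Data.List.Membership.Propositional using (_∈_)
open import Data.List.Membership.Propositional.Properties
  using (∈-lookup; ∈-allFin; ∈-++⁺ˡ; ∈-++⁺ʳ; ∈-++⁻)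
open import Data.List.Relation.Binary.Permutation.Propositional
  using (_↭_; ↭-refl; ↭-sym; ↭-trans; ↭-reflexive; prep; swap)
  using (module PermutationReasoning)
open import Data.List.Relation.Binary.Permutation.Propositional.Properties
  using (All-resp-↭; ∈-resp-↭; ↭-length; shifts; ++⁺ˡ; ++⁺ʳ)
open import Data.Product.Base using (_×_; _,_; ∃₂; proj₁; proj₂) renaming (map to map×)
open import Data.Sum.Base using (_⊎_; inj₁; inj₂)
open import Data.Empty using (⊥-elim)
open import Function.Base using (_∘_)
open import Relation.Binary.Definitions using (Symmetric; Decidable)
open import Relation.Nullary using (¬_; yes; no)
open import Relation.Binary.PropositionalEquality
  using (_≡_; _≢_; refl; cong; cong₂; subst; subst₂; module ≡-Reasoning)
  renaming (sym to ≡-sym; trans to ≡-trans)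

2≤∣m-n∣ : ∀ m n → m ≢ n → n ≢ suc m → m ≢ suc n → 2 ≤ ∣ m - n ∣
2≤∣m-n∣ zero          zero          m≢n _ _ = ⊥-elim (m≢n refl)
2≤∣m-n∣ zero          (suc zero)    _ n≢1+m _ = ⊥-elim (n≢1+m refl)
2≤∣m-n∣ zero          (suc (suc n)) _ _ _ = s≤s (s≤s z≤n)
2≤∣m-n∣ (suc zero)    zero          _ _ m≢1+n = ⊥-elim (m≢1+n refl)
2≤∣m-n∣ (suc (suc m)) zero          _ _ _ = s≤s (s≤s z≤n)
2≤∣m-n∣ (suc m)       (suc n)       m≢n n≢1+m m≢1+n =
  2≤∣m-n∣ m n (m≢n ∘ cong suc) (n≢1+m ∘ cong suc) (m≢1+n ∘ cong suc)

endpoints : {A : Set} → List (A × A) → List A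
endpoints []            = []
endpoints ((a , b) ∷ ps) = a ∷ b ∷ endpoints ps

module _ {A : Set} {R : A → A → Set} where

  Linked-consecutive : ∀ {xs} → Linked R xs → (i j : Fin (length xs)) →
                       toℕ j ≡ suc (toℕ i) → R (lookup xs i) (lookup xs j)
  Linked-consecutive (r ∷ _)  fzero    (fsuc fzero)    _  = r
  Linked-consecutive (_ ∷ rs) (fsuc i) (fsuc j)        ij =
    Linked-consecutive rs i j (cong pred ij)
  Linked-consecutive [-]      fzero    fzero           ()
  Linked-consecutive (_ ∷ _)  fzero    fzero           ()
  Linked-consecutive (_ ∷ _)  fzero    (fsuc (fsuc _)) ()
  Linked-consecutive (_ ∷ _)  (fsuc _) fzero           ()

  AllPairs-lookup : Symmetric R → ∀ {xs} → AllPairs R xs →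
                    ∀ {i j} → i ≢ j → R (lookup xs i) (lookup xs j)
  AllPairs-lookup _   (_ ∷ _)  {fzero}  {fzero}  i≢j = ⊥-elim (i≢j refl)
  AllPairs-lookup _   (r ∷ _)  {fzero}  {fsuc j} _   = All.lookup r (∈-lookup j)
  AllPairs-lookup sym (r ∷ _)  {fsuc i} {fzero}  _   = sym (All.lookup r (∈-lookup i))
  AllPairs-lookup sym (_ ∷ rs) {fsuc i} {fsuc j} i≢j =
    AllPairs-lookup sym rs (i≢j ∘ cong fsuc)

  all-related⊎split : Decidable R → ∀ x {ys} → AllPairs R ys →
                      All (R x) ys ⊎ ∃₂ λ y zs → ¬ R x y × AllPairs R zs × ys ↭ y ∷ zs
  all-related⊎split R? x [] = inj₁ []
  all-related⊎split R? x {y ∷ ys} (y~ys ∷ ys-pairs)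
    with R? x y | all-related⊎split R? x ys-pairs
  ... | no x≁y  | _          = inj₂ (y , ys , x≁y , ys-pairs , ↭-refl)
  ... | yes x~y | inj₁ x~ys = inj₁ (x~y ∷ x~ys)
  ... | yes _   | inj₂ (w , zs , x≁w , zs-pairs , ys↭w∷zs) =
    inj₂ (w , y ∷ zs , x≁w , All.tail (All-resp-↭ ys↭w∷zs y~ys) ∷ zs-pairs ,
          ↭-trans (prep y ys↭w∷zs) (swap y w ↭-refl))

module _ {V : Set} {A : V → V → Set}
         (A-sym : ∀ x y → A x y → A y x) (A-irr : ∀ x → ¬ A x x) where

  Lambda≤-enumeration : ∀ {k} (s : List V) → Linked (λ x y → ¬ A x y) s →
                        (∀ v → v ∈ s) → length s ≡ suc k → Lambda≤ A k
  Lambda≤-enumeration {k} s apart covers |s|≡1+k = label , (adjacent , distance-two) , bounded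
    where
    position : V → Fin (length s)
    position v = index (covers v)

    label : V → ℕ
    label = toℕ ∘ position

    at-position : ∀ v → v ≡ lookup s (position v)
    at-position v = lookup-index (covers v)

    label-injective : ∀ {x y} → label x ≡ label y → x ≡ y
    label-injective {x} {y} e =
      subst₂ _≡_ (≡-sym (at-position x)) (≡-sym (at-position y))
        (cong (lookup s) (toℕ-injective e))

    not-consecutive : ∀ {x y} → A x y → label y ≢ suc (label x)
    not-consecutive {x} {y} x~y e =
      Linked-consecutive apart (position x) (position y) e
        (subst₂ A (at-position x) (at-position y) x~y)

    adjacent : ∀ x y → A x y → 2 ≤ ∣ label x - label y ∣
    adjacent x y x~y = 2≤∣m-n∣ (label x) (label y)
      (λ e → A-irr y (subst (λ z → A z y) (label-injective e) x~y))
      (not-consecutive x~y) (not-consecutive (A-sym x y x~y))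

    distance-two : ∀ x y → Dist2 A x y → label x ≢ label y
    distance-two x y (x≢y , _) = x≢y ∘ label-injective

    bounded : ∀ v → label v ≤ k
    bounded v = ≤-pred (≤-trans (toℕ<n (position v)) (≤-reflexive |s|≡1+k))

module _ {n : ℕ} (G : Graph n) where

  clique-length≤ : ∀ {m L} → CliqueNumber≤ G m → AllPairs (Adj G) L → length L ≤ m
  clique-length≤ {L = L} ω≤m L-clique =
    ω≤m (length L) (lookup L) (lookup-injective , λ _ _ → AllPairs-lookup (sym G) L-clique)
    where
    lookup-injective : ∀ {i j} → lookup L i ≡ lookup L j → i ≡ j
    lookup-injective {i} {j} e with i ≟ j
    ... | yes i≡j = i≡j
    ... | no  i≢j =
      ⊥-elim (irr G (subst (Adj G (lookup L i)) (≡-sym e) (AllPairs-lookup (sym G) L-clique i≢j)))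

  NonAdjacent : Fin n × Fin n → Set
  NonAdjacent (a , b) = ¬ Adj G a b

  record Decomposition (xs : List (Fin n)) : Set where
    constructor decomposition
    field
      pairs     : List (Fin n × Fin n)
      clique    : List (Fin n)
      apart     : All NonAdjacent pairs
      isClique  : AllPairs (Adj G) clique
      partition : clique ++ endpoints pairs ↭ xs

  decompose : ∀ xs → Decomposition xs
  decompose []       = decomposition [] [] [] [] ↭-refl
  decompose (x ∷ xs) = extend (decompose xs)
    where
    extend : Decomposition xs → Decomposition (x ∷ xs)
    extend (decomposition P L P-apart L-clique part)
      with all-related⊎split (adj? G) x L-clique
    ... | inj₁ x~L = decomposition P (x ∷ L) P-apart (x~L ∷ L-clique) (prep x part)
    ... | inj₂ (y , L′ , x≁y , L′-clique , L↭y∷L′) =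
      decomposition ((x , y) ∷ P) L′ (x≁y ∷ P-apart) L′-clique part′
      where
      open PermutationReasoning
      part′ : L′ ++ x ∷ y ∷ endpoints P ↭ x ∷ xs
      part′ = begin
        L′ ++ x ∷ y ∷ endpoints P   ↭⟨ shifts L′ (x ∷ y ∷ []) ⟩
        x ∷ y ∷ L′ ++ endpoints P   ↭⟨ prep x (++⁺ʳ (endpoints P) (↭-sym L↭y∷L′)) ⟩
        x ∷ L ++ endpoints P        ↭⟨ prep x part ⟩
        x ∷ xs                      ∎

  MAdj-sym : ∀ x y → MAdj G x y → MAdj G y x
  MAdj-sym (orig _) (orig _) a = sym G a
  MAdj-sym (orig _) (copy _) a = a
  MAdj-sym (copy _) (orig _) a = a
  MAdj-sym (copy _) root     a = a
  MAdj-sym root     (copy _) a = a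

  MAdj-irr : ∀ x → ¬ MAdj G x x
  MAdj-irr (orig _) = irr G
  MAdj-irr (copy _) ()
  MAdj-irr root     ()

  Apart : MV n → MV n → Set
  Apart x y = ¬ MAdj G x y

  data Piece : Set where
    up down : Fin n → Piece

  vertex : Piece → Fin n
  vertex (up z)   = z
  vertex (down z) = z

  unfold : List Piece → List (MV n)
  unfold []            = []
  unfold (up z ∷ ps)   = orig z ∷ copy z ∷ unfold ps
  unfold (down z ∷ ps) = copy z ∷ orig z ∷ unfold ps

  length-unfold : ∀ ps → length (unfold ps) ≡ 2 * length ps
  length-unfold []            = refl
  length-unfold (up _ ∷ ps)   = ≡-trans (cong (2 +_) (length-unfold ps)) (≡-sym (*-suc 2 (length ps)))
  length-unfold (down _ ∷ ps) = ≡-trans (cong (2 +_) (length-unfold ps)) (≡-sym (*-suc 2 (length ps)))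

  ∈-unfold : ∀ ps {z} → z ∈ map vertex ps → orig z ∈ unfold ps × copy z ∈ unfold ps
  ∈-unfold (up _ ∷ _)   (here refl) = here refl , there (here refl)
  ∈-unfold (down _ ∷ _) (here refl) = there (here refl) , here refl
  ∈-unfold (up _ ∷ ps)   (there z∈) = map× (there ∘ there) (there ∘ there) (∈-unfold ps z∈)
  ∈-unfold (down _ ∷ ps) (there z∈) = map× (there ∘ there) (there ∘ there) (∈-unfold ps z∈)

  blocks : List (Fin n × Fin n) → List Piece
  blocks []             = []
  blocks ((a , b) ∷ P) = down a ∷ up b ∷ blocks P

  vertices-blocks : ∀ P t → map vertex (blocks P ++ t) ↭ map vertex t ++ endpoints P
  vertices-blocks []            t = ↭-reflexive (≡-sym (++-identityʳ (map vertex t)))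
  vertices-blocks ((a , b) ∷ P) t =
    ↭-trans (prep a (prep b (vertices-blocks P t))) (shifts (a ∷ b ∷ []) (map vertex t))

  FollowsCopy : List Piece → Set
  FollowsCopy t = ∀ c → Linked Apart (copy c ∷ unfold t)

  []-follows-copy : FollowsCopy []
  []-follows-copy _ = [-]

  down-follows-copy : ∀ l → FollowsCopy (down l ∷ [])
  down-follows-copy _ _ = (λ ()) ∷ irr G ∷ [-]

  blocks-follow-copy : ∀ {P t} → All NonAdjacent P → FollowsCopy t → FollowsCopy (blocks P ++ t)
  blocks-follow-copy []                            t-follows _ = t-follows _
  blocks-follow-copy {(a , b) ∷ _} (a≁b ∷ P-apart) t-follows _ =
    (λ ()) ∷ irr G ∷ a≁b ∷ irr G ∷ blocks-follow-copy P-apart t-follows b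

  Lambda≤-frame : (left right : List Piece) → Linked Apart (unfold left ++ root ∷ unfold right) →
                  map vertex left ++ map vertex right ↭ allFin n → Lambda≤ (MAdj G) (2 * n)
  Lambda≤-frame left right linked part =
    Lambda≤-enumeration MAdj-sym MAdj-irr s linked covers length-s
    where
    s : List (MV n)
    s = unfold left ++ root ∷ unfold right

    both-sides : ∀ z → orig z ∈ s × copy z ∈ s
    both-sides z with ∈-++⁻ (map vertex left) (∈-resp-↭ (↭-sym part) (∈-allFin z))
    ... | inj₁ z∈left  = map× ∈-++⁺ˡ ∈-++⁺ˡ (∈-unfold left z∈left)
    ... | inj₂ z∈right =
      map× (∈-++⁺ʳ _ ∘ there) (∈-++⁺ʳ _ ∘ there) (∈-unfold right z∈right)

    covers : ∀ v → v ∈ s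
    covers (orig z) = proj₁ (both-sides z)
    covers (copy z) = proj₂ (both-sides z)
    covers root     = ∈-++⁺ʳ (unfold left) (here refl)

    length-s : length s ≡ suc (2 * n)
    length-s = begin
      length (unfold left ++ root ∷ unfold right)
        ≡⟨ length-++ (unfold left) ⟩
      length (unfold left) + suc (length (unfold right))
        ≡⟨ cong₂ (λ a b → a + suc b) (length-unfold left) (length-unfold right) ⟩
      2 * length left + suc (2 * length right)
        ≡⟨ arith (length left) (length right) ⟩
      suc (2 * (length left + length right))
        ≡⟨ cong (suc ∘ (2 *_)) vertex-count ⟩
      suc (2 * n)
        ∎
      where
      open ≡-Reasoning
      arith : ∀ a b → 2 * a + suc (2 * b) ≡ suc (2 * (a + b))
      arith = solve-∀
      vertex-count : length left + length right ≡ n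
      vertex-count = begin
        length left + length right
          ≡⟨ cong₂ _+_ (≡-sym (length-map vertex left)) (≡-sym (length-map vertex right)) ⟩
        length (map vertex left) + length (map vertex right)
          ≡⟨ ≡-sym (length-++ (map vertex left)) ⟩
        length (map vertex left ++ map vertex right)
          ≡⟨ ↭-length part ⟩
        length (allFin n)
          ≡⟨ length-tabulate (λ z → z) ⟩
        n
          ∎

  PrecedesRoot : List Piece → Set
  PrecedesRoot left = ∀ {xs} → Linked Apart (root ∷ xs) → Linked Apart (unfold left ++ root ∷ xs)

  []-precedes-root : PrecedesRoot []
  []-precedes-root linked = linked

  up-down-precedes-root : ∀ l₁ l₂ → PrecedesRoot (up l₁ ∷ down l₂ ∷ [])
  up-down-precedes-root _ _ linked = irr G ∷ (λ ()) ∷ irr G ∷ (λ ()) ∷ linked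

  Lambda≤-around-blocks : ∀ left l t {P} → PrecedesRoot left → FollowsCopy t →
                          All NonAdjacent P →
                          (map vertex left ++ l ∷ map vertex t) ++ endpoints P ↭ allFin n →
                          Lambda≤ (MAdj G) (2 * n)
  Lambda≤-around-blocks left l t {P} left-precedes t-follows P-apart part =
    Lambda≤-frame left (up l ∷ blocks P ++ t)
      (left-precedes ((λ ()) ∷ irr G ∷ blocks-follow-copy P-apart t-follows l))
      (↭-trans (++⁺ˡ (map vertex left) (prep l (vertices-blocks P t)))
        (↭-trans (↭-reflexive (≡-sym (++-assoc (map vertex left) (l ∷ map vertex t) (endpoints P))))
          part))

  -- The root is adjacent to every copy, and v_l is adjacent to v_m and v_m' for clique
  -- vertices l ≠ m, so the original of each clique vertex must lie next to the root or
  -- at an end of the list: this is why the leftover clique may have at most four vertices.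
  Lambda≤-decomposition : (P : List (Fin n × Fin n)) (L : List (Fin n)) → length L ≤ 4 →
                          All NonAdjacent P → L ++ endpoints P ↭ allFin n →
                          Lambda≤ (MAdj G) (2 * n)
  Lambda≤-decomposition []            [] _ _ part = Lambda≤-frame [] [] [-] part
  Lambda≤-decomposition ((a , b) ∷ P) [] _ (_ ∷ P-apart) part =
    Lambda≤-decomposition P (a ∷ b ∷ []) (s≤s (s≤s z≤n)) P-apart part
  Lambda≤-decomposition P (l₁ ∷ []) _ =
    Lambda≤-around-blocks [] l₁ [] []-precedes-root []-follows-copy
  Lambda≤-decomposition P (l₁ ∷ l₂ ∷ []) _ =
    Lambda≤-around-blocks [] l₁ (down l₂ ∷ []) []-precedes-root (down-follows-copy l₂)
  Lambda≤-decomposition P (l₁ ∷ l₂ ∷ l₃ ∷ []) _ =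
    Lambda≤-around-blocks (up l₁ ∷ down l₂ ∷ []) l₃ []
      (up-down-precedes-root l₁ l₂) []-follows-copy
  Lambda≤-decomposition P (l₁ ∷ l₂ ∷ l₃ ∷ l₄ ∷ []) _ =
    Lambda≤-around-blocks (up l₁ ∷ down l₂ ∷ []) l₃ (down l₄ ∷ [])
      (up-down-precedes-root l₁ l₂) (down-follows-copy l₄)
  Lambda≤-decomposition P (_ ∷ _ ∷ _ ∷ _ ∷ _ ∷ _) (s≤s (s≤s (s≤s (s≤s ()))))

corollary3p2 : (n : ℕ) (G : Graph n) → CliqueNumber≤ G 4 → Lambda≤ (MAdj G) (2 * n)
corollary3p2 n G ω≤4 =
  Lambda≤-decomposition G pairs clique (clique-length≤ G ω≤4 isClique) apart partition
  where open Decomposition (decompose G (allFin n))
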